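{- Let $d\geqslant 2$. Every $(d-1)$-neighborly family $F\subseteq S^d$ of maximum possible size is a partition, i.e. $\sum_{x\in F}2^{j(x)}=2^d$.
   Context: Let $S=\{0,1,\ast\}$ and let $S^d$ be the set of strings of length $d$ over $S$; the symbol $\ast$ is called a joker, and $j(x)$ denotes the number of jokers in $x\in S^d$. For $x,y\in S^d$, $d(x,y)$ is the number of positions $i$ such that one of $x_i,y_i$ is $0$ and the other is $1$. A family $F\subseteq S^d$ is $k$-neighborly if $1\leqslant d(x,y)\leqslant k$ for every two distinct $x,y\in F$. A $k$-neighborly family $F$ is called a partition if $\mathrm{vol}(F):=\sum_{x\in F}2^{j(x)}=2^d$. -}

module Defs where

open import Data.Nat using (ℕ; zero; suc; _+_; _*_; _^_; _≤_)
open import Data.Vec using (Vec; []; _∷_)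
open import Data.List using (List; length)
open import Data.List.Relation.Unary.Unique.Propositional using (Unique)
open import Data.List.Membership.Propositional using (_∈_)
open import Data.Product using (_×_)
open import Relation.Binary.PropositionalEquality using (_≡_; _≢_)

-- The alphabet S = {0, 1, *}; `joker` is the symbol *.
data S : Set where
  s0 s1 joker : S

j : ∀ {d} → Vec S d → ℕ
j [] = 0
j (joker ∷ xs) = suc (j xs)
j (s0 ∷ xs) = j xs
j (s1 ∷ xs) = j xs

δ : S → S → ℕ
δ s0 s1 = 1
δ s1 s0 = 1
δ _ _ = 0

dist : ∀ {d} → Vec S d → Vec S d → ℕ
dist [] [] = 0
dist (a ∷ xs) (b ∷ ys) = δ a b + dist xs ys

record Neighborly {d : ℕ} (k : ℕ) (F : List (Vec S d)) : Set where
  field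
    distinct : Unique F
    close : ∀ {x y} → x ∈ F → y ∈ F → x ≢ y → (1 ≤ dist x y) × (dist x y ≤ k)

vol : ∀ {d} → List (Vec S d) → ℕ
vol List.[] = 0
vol (x List.∷ F) = 2 ^ j x + vol F

-- A family with 1 ≤ d(x,y) for all distinct members is a family of pairwise disjoint
-- subcubes of {0,1}^d, so its volume is at most 2^d; this gives vol F ≤ 2^d.
-- Conversely, the vertices of 0{0,1}^(d-1) together with the subcubes 1*{0,1}^(d-2)
-- form a (d-1)-neighborly family of size 3·2^(d-2), so a maximum family F has at least
-- that many members. A (d-1)-neighborly family contains no two antipodal vertices, so
-- at most 2^(d-1) of its members are vertices (volume 1); every other member has volume
-- at least 2. Hence 2·3·2^(d-2) ≤ 2|F| ≤ vol F + 2^(d-1), that is 2^d ≤ vol F.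

module Submission where

open import Defs
open import Data.Nat using (ℕ; _≤_; _^_; _∸_)
open import Data.Vec using (Vec)
open import Data.List using (List; length)
open import Relation.Binary.PropositionalEquality using (_≡_)

open import Data.Bool using (Bool; true; false)
open import Data.List using ([]; _∷_; [_]; map; filter; _++_)
open import Data.List.Properties using (length-map; length-++)
open import Data.List.Membership.Propositional using (_∈_)
open import Data.List.Membership.Propositional.Properties using (∈-AllPairs₂)
open import Data.List.Relation.Unary.All as All using (All; []; _∷_)
open import Data.List.Relation.Unary.All.Properties as All using (all-filter)
open import Data.List.Relation.Unary.AllPairs as AllPairs using (AllPairs; []; _∷_)
import Data.List.Relation.Unary.AllPairs.Properties as AllPairs
open import Data.List.Relation.Unary.Any using (here; there)
open import Data.Nat using (zero; suc; _+_; _*_; _<_; z≤n; s≤s; _≟_)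
open import Data.Nat.Properties
open import Data.Nat.Tactic.RingSolver using (solve-∀)
open import Data.Product using (_×_; _,_; proj₁)
open import Data.Sum using (inj₁; inj₂)
open import Data.Vec using ([]; _∷_; head; tail)
open import Function using (_∘_)
open import Relation.Binary.PropositionalEquality
  using (_≢_; refl; sym; trans; cong; cong₂; subst; module ≡-Reasoning)
open import Relation.Nullary using (contradiction)
open import Relation.Unary using (Decidable)

private
  variable
    n k : ℕ

guarded-allPairs : ∀ {A : Set} {P : A → Set} {R : A → A → Set} {xs : List A} →
                   AllPairs (λ x y → P x → P y → R x y) xs → All P xs → AllPairs R xs
guarded-allPairs [] [] = []
guarded-allPairs (rs ∷ rss) (p ∷ ps) =
  All.zipWith (λ (r , q) → r p q) (rs , ps) ∷ guarded-allPairs rss ps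

allPairs-∈ : ∀ {A : Set} {R Q : A → A → Set} {xs : List A} → AllPairs Q xs →
             (∀ {x y} → x ∈ xs → y ∈ xs → Q x y → R x y) → AllPairs R xs
allPairs-∈ [] _ = []
allPairs-∈ (qs ∷ qss) f =
  All.tabulate (λ y∈ → f (here refl) (there y∈) (All.lookup qs y∈))
  ∷ allPairs-∈ qss (λ x∈ y∈ → f (there x∈) (there y∈))

cross-All : ∀ {A B C : Set} {R : C → C → Set} (f : A → C) (g : B → C) →
            (∀ a b → R (f a) (g b)) → (as : List A) (bs : List B) →
            All (λ x → All (R x) (map g bs)) (map f as)
cross-All f g r as bs = All.map⁺ (All.universal (λ a → All.map⁺ (All.universal (r a) bs)) as)

δ-sym : ∀ a b → δ a b ≡ δ b a
δ-sym s0 s0 = refl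
δ-sym s0 s1 = refl
δ-sym s0 joker = refl
δ-sym s1 s0 = refl
δ-sym s1 s1 = refl
δ-sym s1 joker = refl
δ-sym joker s0 = refl
δ-sym joker s1 = refl
δ-sym joker joker = refl

δ≤1 : ∀ a b → δ a b ≤ 1
δ≤1 s0 s1 = ≤-refl
δ≤1 s1 s0 = ≤-refl
δ≤1 s0 s0 = z≤n
δ≤1 s0 joker = z≤n
δ≤1 s1 s1 = z≤n
δ≤1 s1 joker = z≤n
δ≤1 joker _ = z≤n

δ-joker : ∀ a → δ a joker ≡ 0
δ-joker s0 = refl
δ-joker s1 = refl
δ-joker joker = refl

dist-sym : (x y : Vec S n) → dist x y ≡ dist y x
dist-sym [] [] = refl
dist-sym (a ∷ x) (b ∷ y) = cong₂ _+_ (δ-sym a b) (dist-sym x y)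

dist≤dim : (x y : Vec S n) → dist x y ≤ n
dist≤dim [] [] = z≤n
dist≤dim (a ∷ x) (b ∷ y) = +-mono-≤ (δ≤1 a b) (dist≤dim x y)

dist-self : (x : Vec S n) → dist x x ≡ 0
dist-self [] = refl
dist-self (s0 ∷ x) = dist-self x
dist-self (s1 ∷ x) = dist-self x
dist-self (joker ∷ x) = dist-self x

Disjoint : Vec S n → Vec S n → Set
Disjoint x y = 1 ≤ dist x y

Neighbours : ℕ → Vec S n → Vec S n → Set
Neighbours k x y = Disjoint x y × dist x y ≤ k

Disjoint-sym : {x y : Vec S n} → Disjoint x y → Disjoint y x
Disjoint-sym {x = x} {y} = subst (1 ≤_) (dist-sym x y)

Neighbours-sym : {x y : Vec S n} → Neighbours k x y → Neighbours k y x
Neighbours-sym {x = x} {y} (x#y , x~y) = Disjoint-sym {x = x} x#y , subst (_≤ _) (dist-sym x y) x~y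

Disjoint⇒≢ : {x y : Vec S n} → Disjoint x y → x ≢ y
Disjoint⇒≢ {x = x} x#y refl = <-irrefl (sym (dist-self x)) x#y

neighborly⇒allPairs : {F : List (Vec S n)} → Neighborly k F → AllPairs (Neighbours k) F
neighborly⇒allPairs nF = allPairs-∈ (Neighborly.distinct nF) (Neighborly.close nF)

allPairs⇒neighborly : {F : List (Vec S n)} → AllPairs (Neighbours k) F → Neighborly k F
allPairs⇒neighborly {n} {k} {F} nF = record
  { distinct = AllPairs.map (Disjoint⇒≢ ∘ proj₁) nF
  ; close = close
  }
  where
  close : {x y : Vec S n} → x ∈ F → y ∈ F → x ≢ y → Neighbours k x y
  close {x} {y} x∈ y∈ x≢y with ∈-AllPairs₂ nF x∈ y∈
  ... | inj₁ x≡y = contradiction x≡y x≢y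
  ... | inj₂ (inj₁ x~y) = x~y
  ... | inj₂ (inj₂ y~x) = Neighbours-sym {x = y} y~x

bit : Bool → S
bit false = s0
bit true = s1

-- x meets the half-cube whose first coordinate is bit b.
Meets : Bool → Vec S (suc n) → Set
Meets b x = δ (bit b) (head x) ≡ 0

meets? : ∀ b → Decidable (Meets {n} b)
meets? b x = δ (bit b) (head x) ≟ 0

slice : Bool → List (Vec S (suc n)) → List (Vec S n)
slice b F = map tail (filter (meets? b) F)

δ-meets : ∀ b a c → δ (bit b) a ≡ 0 → δ (bit b) c ≡ 0 → δ a c ≡ 0
δ-meets false s0 s0 _ _ = refl
δ-meets false s0 joker _ _ = refl
δ-meets false joker c _ _ = refl
δ-meets true s1 s1 _ _ = refl
δ-meets true s1 joker _ _ = refl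
δ-meets true joker c _ _ = refl

Disjoint-tail : ∀ b {x y : Vec S (suc n)} → Meets b x → Meets b y →
                Disjoint x y → Disjoint (tail x) (tail y)
Disjoint-tail b {a ∷ x} {c ∷ y} ma mc x#y =
  subst (λ e → 1 ≤ e + dist x y) (δ-meets b a c ma mc) x#y

Disjoint-slice : ∀ b {F : List (Vec S (suc n))} → AllPairs Disjoint F →
                 AllPairs Disjoint (slice b F)
Disjoint-slice b {F} F# = AllPairs.map⁺ (guarded-allPairs
  (AllPairs.filter⁺ (meets? b)
    (AllPairs.map (λ {x} {y} x#y mx my → Disjoint-tail b {x} {y} mx my x#y) F#))
  (all-filter (meets? b) F))

vol-slice : (F : List (Vec S (suc n))) → vol F ≡ vol (slice false F) + vol (slice true F)
vol-slice [] = refl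
vol-slice ((s0 ∷ x) ∷ F) =
  trans (cong (2 ^ j x +_) (vol-slice F)) (sym (+-assoc (2 ^ j x) (vol (slice false F)) _))
vol-slice ((s1 ∷ x) ∷ F) =
  trans (cong (2 ^ j x +_) (vol-slice F)) (+-assoc-comm (2 ^ j x) (vol (slice false F)) _)
  where
  +-assoc-comm : ∀ a b c → a + (b + c) ≡ b + (a + c)
  +-assoc-comm = solve-∀
vol-slice ((joker ∷ x) ∷ F) =
  trans (cong (2 * 2 ^ j x +_) (vol-slice F)) (double-split (2 ^ j x) (vol (slice false F)) _)
  where
  double-split : ∀ a b c → 2 * a + (b + c) ≡ (a + b) + (a + c)
  double-split = solve-∀

vol≤2^ : (F : List (Vec S n)) → AllPairs Disjoint F → vol F ≤ 2 ^ n
vol≤2^ {zero} [] _ = z≤n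
vol≤2^ {zero} ([] ∷ []) _ = ≤-refl
vol≤2^ {zero} ([] ∷ [] ∷ _) ((() ∷ _) ∷ _)
vol≤2^ {suc n} F F# = begin
  vol F                                       ≡⟨ vol-slice F ⟩
  vol (slice false F) + vol (slice true F)    ≤⟨ +-mono-≤ (vol≤2^ _ (Disjoint-slice false F#))
                                                           (vol≤2^ _ (Disjoint-slice true F#)) ⟩
  2 ^ n + 2 ^ n                               ≡⟨ cong (2 ^ n +_) (sym (+-identityʳ (2 ^ n))) ⟩
  2 ^ suc n                                   ∎
  where open ≤-Reasoning

Vertex : Vec S n → Set
Vertex x = j x ≡ 0

vertex? : Decidable (Vertex {n})
vertex? x = j x ≟ 0

complement : Vec S n → Vec S n
complement [] = []
complement (s0 ∷ x) = s1 ∷ complement x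
complement (s1 ∷ x) = s0 ∷ complement x
complement (joker ∷ x) = joker ∷ complement x

dist-complement-complement : (x y : Vec S n) → dist (complement x) (complement y) ≡ dist x y
dist-complement-complement [] [] = refl
dist-complement-complement (s0 ∷ x) (s0 ∷ y) = dist-complement-complement x y
dist-complement-complement (s0 ∷ x) (s1 ∷ y) = cong suc (dist-complement-complement x y)
dist-complement-complement (s0 ∷ x) (joker ∷ y) = dist-complement-complement x y
dist-complement-complement (s1 ∷ x) (s0 ∷ y) = cong suc (dist-complement-complement x y)
dist-complement-complement (s1 ∷ x) (s1 ∷ y) = dist-complement-complement x y
dist-complement-complement (s1 ∷ x) (joker ∷ y) = dist-complement-complement x y
dist-complement-complement (joker ∷ x) (s0 ∷ y) = dist-complement-complement x y
dist-complement-complement (joker ∷ x) (s1 ∷ y) = dist-complement-complement x y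
dist-complement-complement (joker ∷ x) (joker ∷ y) = dist-complement-complement x y

dist+dist-complement : (x y : Vec S n) → Vertex x → Vertex y → dist x y + dist x (complement y) ≡ n
dist+dist-complement [] [] _ _ = refl
dist+dist-complement (s0 ∷ x) (s0 ∷ y) vx vy =
  trans (+-suc (dist x y) _) (cong suc (dist+dist-complement x y vx vy))
dist+dist-complement (s1 ∷ x) (s1 ∷ y) vx vy =
  trans (+-suc (dist x y) _) (cong suc (dist+dist-complement x y vx vy))
dist+dist-complement (s0 ∷ x) (s1 ∷ y) vx vy = cong suc (dist+dist-complement x y vx vy)
dist+dist-complement (s1 ∷ x) (s0 ∷ y) vx vy = cong suc (dist+dist-complement x y vx vy)
dist+dist-complement (s0 ∷ x) (joker ∷ y) vx ()
dist+dist-complement (s1 ∷ x) (joker ∷ y) vx ()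
dist+dist-complement (joker ∷ x) y () vy

Disjoint-complement : (x y : Vec S n) → Vertex x → Vertex y → dist x y < n →
                      Disjoint x (complement y)
Disjoint-complement x y vx vy x~y with dist x (complement y) | dist+dist-complement x y vx vy
... | suc _ | _ = s≤s z≤n
... | zero | sum = contradiction (trans (sym (+-identityʳ (dist x y))) sum) (<⇒≢ x~y)

-- The representative of the antipodal pair {x, complement x} with first coordinate 0,
-- with that coordinate dropped.
normalise : Vec S (suc n) → Vec S n
normalise (s0 ∷ x) = x
normalise (s1 ∷ x) = complement x
normalise (joker ∷ x) = x

Disjoint-normalise : (x y : Vec S (suc n)) → Vertex x → Vertex y → Neighbours n x y →
                     Disjoint (normalise x) (normalise y)
Disjoint-normalise (s0 ∷ x) (s0 ∷ y) _ _ (x#y , _) = x#y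
Disjoint-normalise (s1 ∷ x) (s1 ∷ y) _ _ (x#y , _) =
  subst (1 ≤_) (sym (dist-complement-complement x y)) x#y
Disjoint-normalise (s0 ∷ x) (s1 ∷ y) vx vy (_ , x~y) = Disjoint-complement x y vx vy x~y
Disjoint-normalise (s1 ∷ x) (s0 ∷ y) vx vy (_ , x~y) =
  Disjoint-sym {x = y} (Disjoint-complement y x vy vx (subst (_< _) (dist-sym x y) x~y))
Disjoint-normalise (s0 ∷ x) (joker ∷ y) _ ()
Disjoint-normalise (s1 ∷ x) (joker ∷ y) _ ()
Disjoint-normalise (joker ∷ x) y ()

length≤vol : (F : List (Vec S n)) → length F ≤ vol F
length≤vol [] = z≤n
length≤vol (x ∷ F) = +-mono-≤ (m^n>0 2 (j x)) (length≤vol F)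

vertex-count : (F : List (Vec S (suc n))) → AllPairs (Neighbours n) F →
               length (filter vertex? F) ≤ 2 ^ n
vertex-count {n} F F~ = begin
  length (filter vertex? F) ≡⟨ length-map normalise (filter vertex? F) ⟨
  length images             ≤⟨ length≤vol images ⟩
  vol images                ≤⟨ vol≤2^ images images-disjoint ⟩
  2 ^ n                     ∎
  where
  open ≤-Reasoning
  images : List (Vec S n)
  images = map normalise (filter vertex? F)
  images-disjoint : AllPairs Disjoint images
  images-disjoint = AllPairs.map⁺ (guarded-allPairs
    (AllPairs.filter⁺ vertex?
      (AllPairs.map (λ {x} {y} x~y vx vy → Disjoint-normalise x y vx vy x~y) F~))
    (all-filter vertex? F))

-- Vertices have volume 1 and all other members volume at least 2.
double-length≤vol+vertices : (F : List (Vec S n)) →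
                             2 * length F ≤ vol F + length (filter vertex? F)
double-length≤vol+vertices [] = z≤n
double-length≤vol+vertices (x ∷ F) with j x
... | zero = begin
  2 * suc (length F)                            ≡⟨ *-suc 2 (length F) ⟩
  2 + 2 * length F                              ≤⟨ +-monoʳ-≤ 2 (double-length≤vol+vertices F) ⟩
  2 + (vol F + length (filter vertex? F))       ≡⟨ shuffle (vol F) _ ⟩
  (1 + vol F) + suc (length (filter vertex? F)) ∎
  where
  open ≤-Reasoning
  shuffle : ∀ a b → 2 + (a + b) ≡ (1 + a) + suc b
  shuffle = solve-∀
... | suc k = begin
  2 * suc (length F)                            ≡⟨ *-suc 2 (length F) ⟩
  2 + 2 * length F                              ≤⟨ +-mono-≤ (*-monoʳ-≤ 2 (m^n>0 2 k))
                                                            (double-length≤vol+vertices F) ⟩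
  2 ^ suc k + (vol F + length (filter vertex? F)) ≡⟨ +-assoc (2 ^ suc k) (vol F) _ ⟨
  (2 ^ suc k + vol F) + length (filter vertex? F) ∎
  where open ≤-Reasoning

2*length≤vol+2^ : (F : List (Vec S (suc n))) → AllPairs (Neighbours n) F →
                  2 * length F ≤ vol F + 2 ^ n
2*length≤vol+2^ F F~ =
  ≤-trans (double-length≤vol+vertices F) (+-monoʳ-≤ (vol F) (vertex-count F F~))

-- A large (n+1)-neighborly family in dimension n+2

vertices : ∀ n → List (Vec S n)
vertices zero = [ [] ]
vertices (suc n) = map (s0 ∷_) (vertices n) ++ map (s1 ∷_) (vertices n)

length-vertices : ∀ n → length (vertices n) ≡ 2 ^ n
length-vertices zero = refl
length-vertices (suc n) = begin
  length (map (s0 ∷_) (vertices n) ++ map (s1 ∷_) (vertices n))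
    ≡⟨ length-++ (map (s0 ∷_) (vertices n)) ⟩
  length (map (s0 ∷_) (vertices n)) + length (map (s1 ∷_) (vertices n))
    ≡⟨ cong₂ _+_ (length-map (s0 ∷_) (vertices n)) (length-map (s1 ∷_) (vertices n)) ⟩
  length (vertices n) + length (vertices n)
    ≡⟨ cong (λ v → v + v) (length-vertices n) ⟩
  2 ^ n + 2 ^ n
    ≡⟨ cong (2 ^ n +_) (+-identityʳ (2 ^ n)) ⟨
  2 ^ suc n ∎
  where open ≡-Reasoning

vertices-disjoint : ∀ n → AllPairs Disjoint (vertices n)
vertices-disjoint zero = [] ∷ []
vertices-disjoint (suc n) =
  AllPairs.++⁺ (AllPairs.map⁺ (vertices-disjoint n)) (AllPairs.map⁺ (vertices-disjoint n))
    (cross-All (s0 ∷_) (s1 ∷_) (λ _ _ → s≤s z≤n) (vertices n) (vertices n))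

1*∷_ : Vec S n → Vec S (suc (suc n))
1*∷ z = s1 ∷ joker ∷ z

large-family : ∀ n → List (Vec S (suc (suc n)))
large-family n = map (s0 ∷_) (vertices (suc n)) ++ map 1*∷_ (vertices n)

length-large-family : ∀ n → length (large-family n) ≡ 2 * 2 ^ n + 2 ^ n
length-large-family n = begin
  length (large-family n)
    ≡⟨ length-++ (map (s0 ∷_) (vertices (suc n))) ⟩
  length (map (s0 ∷_) (vertices (suc n))) + length (map 1*∷_ (vertices n))
    ≡⟨ cong₂ _+_ (length-map (s0 ∷_) (vertices (suc n))) (length-map 1*∷_ (vertices n)) ⟩
  length (vertices (suc n)) + length (vertices n)
    ≡⟨ cong₂ _+_ (length-vertices (suc n)) (length-vertices n) ⟩
  2 * 2 ^ n + 2 ^ n ∎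
  where open ≡-Reasoning

large-family-neighbours : ∀ n → AllPairs (Neighbours (suc n)) (large-family n)
large-family-neighbours n = AllPairs.++⁺
  (AllPairs.map⁺ (AllPairs.map (λ {x} {y} x#y → x#y , dist≤dim x y)
                               (vertices-disjoint (suc n))))
  (AllPairs.map⁺ (AllPairs.map (λ {x} {y} x#y → x#y , m≤n⇒m≤1+n (dist≤dim x y))
                               (vertices-disjoint n)))
  (cross-All (s0 ∷_) 1*∷_ across (vertices (suc n)) (vertices n))
  where
  across : (x : Vec S (suc n)) (z : Vec S n) → Neighbours (suc n) (s0 ∷ x) (1*∷ z)
  across (a ∷ x) z rewrite δ-joker a = s≤s z≤n , s≤s (dist≤dim x z)

proposition3p2 : (d : ℕ) → 2 ≤ d → (F : List (Vec S d)) → Neighborly (d ∸ 1) F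
    → (∀ (G : List (Vec S d)) → Neighborly (d ∸ 1) G → length G ≤ length F)
    → vol F ≡ 2 ^ d
proposition3p2 (suc (suc m)) (s≤s (s≤s z≤n)) F neighborly maximum =
  ≤-antisym (vol≤2^ F (AllPairs.map proj₁ F~)) (+-cancelʳ-≤ (2 * 2 ^ m) _ _ (begin
    2 * (2 * 2 ^ m) + 2 * 2 ^ m ≡⟨ *-distribˡ-+ 2 (2 * 2 ^ m) (2 ^ m) ⟨
    2 * (2 * 2 ^ m + 2 ^ m)     ≡⟨ cong (2 *_) (length-large-family m) ⟨
    2 * length (large-family m) ≤⟨ *-monoʳ-≤ 2 (maximum (large-family m) large-neighborly) ⟩
    2 * length F                ≤⟨ 2*length≤vol+2^ F F~ ⟩
    vol F + 2 * 2 ^ m           ∎))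
  where
  open ≤-Reasoning
  F~ : AllPairs (Neighbours (suc m)) F
  F~ = neighborly⇒allPairs neighborly
  large-neighborly : Neighborly (suc m) (large-family m)
  large-neighborly = allPairs⇒neighborly (large-family-neighbours m)
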